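{- Let $n\ge4$. If there exists a set of $\mu'$ mutually orthogonal cyclic $\ell$-cycle systems of order $n$, then $\mu'\le n-3$. That is, $\mu'(\ell,n)\le n-3$.
   Context: An $\ell$-cycle system of order $n$ is a set of $\ell$-cycles whose edge sets partition the edge set of $K_n$. Two such systems $\mathcal F,\mathcal F'$ are orthogonal if every $C\in\mathcal F$ and $C'\in\mathcal F'$ share at most one edge; mutually orthogonal means pairwise orthogonal. With the vertex set of $K_n$ identified with $\mathbb{Z}_n$, a system $\mathcal F$ is cyclic if for every $C=(c_0,\dots,c_{\ell-1})\in\mathcal F$ and $g\in\mathbb{Z}_n$, $C+g=(c_0+g,\dots,c_{\ell-1}+g)\in\mathcal F$. $\mu'(\ell,n)$ is the maximum size of a set of mutually orthogonal cyclic $\ell$-cycle systems of order $n$. -}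

module Defs where

open import Data.Nat using (ℕ; zero; suc; _+_)
open import Data.Nat.DivMod using (_mod_)
open import Data.Fin using (Fin; toℕ)
open import Data.List using (List; length; lookup)
open import Data.Product using (Σ; ∃; _×_; _,_)
open import Data.Sum using (_⊎_)
open import Relation.Binary.PropositionalEquality using (_≡_; _≢_)
open import Function using (_∘_)

-- Vertex set of K_n is ℤ_n, represented by Fin n with addition mod n.
_⊕_ : ∀ {n} → Fin n → Fin n → Fin n
_⊕_ {suc k} x g = (toℕ x + toℕ g) mod (suc k)

next : ∀ {ℓ} → Fin ℓ → Fin ℓ
next {suc k} i = (suc (toℕ i)) mod (suc k)

-- A (representation of an) ℓ-cycle (c_0,…,c_{ℓ-1}) in K_n: a map Fin ℓ → Fin n.
-- It is a genuine cycle when the vertices are pairwise distinct (and ℓ ≥ 3).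
Walk : ℕ → ℕ → Set
Walk ℓ n = Fin ℓ → Fin n

IsCycle : ∀ {ℓ n} → Walk ℓ n → Set
IsCycle c = ∀ i j → c i ≡ c j → i ≡ j

HasEdge : ∀ {ℓ n} → Walk ℓ n → Fin n → Fin n → Set
HasEdge c x y = ∃ λ i → (c i ≡ x × c (next i) ≡ y) ⊎ (c i ≡ y × c (next i) ≡ x)

SameCycle : ∀ {ℓ n} → Walk ℓ n → Walk ℓ n → Set
SameCycle c d = ∀ x y → (HasEdge c x y → HasEdge d x y) × (HasEdge d x y → HasEdge c x y)

shiftC : ∀ {ℓ n} → Fin n → Walk ℓ n → Walk ℓ n
shiftC g c = λ i → c i ⊕ g

record CycleSystem (ℓ n : ℕ) : Set where
  field
    cycles    : List (Walk ℓ n)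
    isCycle   : ∀ k → IsCycle (lookup cycles k)
    partition : ∀ x y → x ≢ y →
                Σ (Fin (length cycles)) λ k →
                  HasEdge (lookup cycles k) x y ×
                  (∀ k′ → HasEdge (lookup cycles k′) x y → k′ ≡ k)
open CycleSystem public

Cyclic : ∀ {ℓ n} → CycleSystem ℓ n → Set
Cyclic {ℓ} {n} F = ∀ k (g : Fin n) →
  ∃ λ k′ → SameCycle (lookup (cycles F) k′) (shiftC g (lookup (cycles F) k))

AtMostOneCommonEdge : ∀ {ℓ n} → Walk ℓ n → Walk ℓ n → Set
AtMostOneCommonEdge {ℓ} {n} c d = ∀ (x y u v : Fin n) →
  HasEdge c x y × HasEdge d x y → HasEdge c u v × HasEdge d u v →
  (x ≡ u × y ≡ v) ⊎ (x ≡ v × y ≡ u)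

Orthogonal : ∀ {ℓ n} → CycleSystem ℓ n → CycleSystem ℓ n → Set
Orthogonal F G = ∀ k k′ → AtMostOneCommonEdge (lookup (cycles F) k) (lookup (cycles G) k′)

-- Let C i be the cycle of F i through the edge {0, 1} and w i the other neighbour of 0 on C i.
-- Two orthogonal cycles cannot share both {0, 1} and {0, w}, so the w i are distinct vertices other
-- than 0 and 1. If none of them is −1 they fit into n − 3 vertices. If w i = −1, translation by 1
-- maps the edge {−1, 0} of C i onto its edge {0, 1}, so C i is invariant under translation and is the
-- Hamiltonian cycle (0, 1, …, n − 1); in particular ℓ ≥ n. A cycle of length ℓ ≥ n in another cyclic
-- system repeats some step c (p + 1) − c p, so it is invariant under a nonzero translation g, and it
-- then shares both {0, 1} and {g, g + 1} with C i; hence m = 1.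

module Submission where

open import Defs
open import Data.Nat using (ℕ; zero; suc; _+_; _∸_; _≤_; _%_; z≤n; s≤s; NonZero)
import Data.Nat.Properties as ℕ
open import Data.Nat.DivMod using (_mod_; %-distribˡ-+; m%n%n≡m%n; m<n⇒m%n≡m; n%n≡0)
open import Data.Fin using (Fin; zero; suc; toℕ; punchOut; _<_; _≟_)
open import Data.Fin.Properties using (toℕ-injective; toℕ-fromℕ<; toℕ<n; injective⇒≤; pigeonhole; punchOut-injective; <⇒≢; any?)
open import Data.List using (length; lookup)
open import Data.Product using (∃; _×_; _,_; proj₁; proj₂)
open import Data.Sum using (_⊎_; inj₁; inj₂; [_,_]′)
open import Data.Empty using (⊥-elim)
open import Function using (_∘_; Injective)
open import Relation.Nullary using (yes; no)
open import Relation.Nullary.Decidable using (decidable-stable)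
open import Relation.Binary.PropositionalEquality

private
  variable
    ℓ n N : ℕ

[m%d+n]%d≡[m+n]%d : ∀ m n d .{{_ : NonZero d}} → (m % d + n) % d ≡ (m + n) % d
[m%d+n]%d≡[m+n]%d m n d = begin
  (m % d + n) % d          ≡⟨ %-distribˡ-+ (m % d) n d ⟩
  (m % d % d + n % d) % d  ≡⟨ cong (λ t → (t + n % d) % d) (m%n%n≡m%n m d) ⟩
  (m % d + n % d) % d      ≡⟨ %-distribˡ-+ m n d ⟨
  (m + n) % d              ∎
  where open ≡-Reasoning

[m+n%d]%d≡[m+n]%d : ∀ m n d .{{_ : NonZero d}} → (m + n % d) % d ≡ (m + n) % d
[m+n%d]%d≡[m+n]%d m n d = begin
  (m + n % d) % d  ≡⟨ cong (_% d) (ℕ.+-comm m (n % d)) ⟩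
  (n % d + m) % d  ≡⟨ [m%d+n]%d≡[m+n]%d n m d ⟩
  (n + m) % d      ≡⟨ cong (_% d) (ℕ.+-comm n m) ⟩
  (m + n) % d      ∎
  where open ≡-Reasoning

toℕ-mod : ∀ m → toℕ (m mod suc N) ≡ m % suc N
toℕ-mod m = toℕ-fromℕ< _

toℕ-⊕ : (x y : Fin (suc N)) → toℕ (x ⊕ y) ≡ (toℕ x + toℕ y) % suc N
toℕ-⊕ x y = toℕ-mod (toℕ x + toℕ y)

⊕-comm : (x y : Fin (suc N)) → x ⊕ y ≡ y ⊕ x
⊕-comm x y = cong (_mod _) (ℕ.+-comm (toℕ x) (toℕ y))

⊕-assoc : (x y z : Fin (suc N)) → (x ⊕ y) ⊕ z ≡ x ⊕ (y ⊕ z)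
⊕-assoc {N} x y z = toℕ-injective (begin
  toℕ ((x ⊕ y) ⊕ z)                ≡⟨ toℕ-⊕ (x ⊕ y) z ⟩
  (toℕ (x ⊕ y) + toℕ z) % d        ≡⟨ cong (λ t → (t + toℕ z) % d) (toℕ-⊕ x y) ⟩
  ((toℕ x + toℕ y) % d + toℕ z) % d ≡⟨ [m%d+n]%d≡[m+n]%d (toℕ x + toℕ y) (toℕ z) d ⟩
  (toℕ x + toℕ y + toℕ z) % d      ≡⟨ cong (_% d) (ℕ.+-assoc (toℕ x) (toℕ y) (toℕ z)) ⟩
  (toℕ x + (toℕ y + toℕ z)) % d    ≡⟨ [m+n%d]%d≡[m+n]%d (toℕ x) (toℕ y + toℕ z) d ⟨
  (toℕ x + (toℕ y + toℕ z) % d) % d ≡⟨ cong (λ t → (toℕ x + t) % d) (toℕ-⊕ y z) ⟨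
  (toℕ x + toℕ (y ⊕ z)) % d        ≡⟨ toℕ-⊕ x (y ⊕ z) ⟨
  toℕ (x ⊕ (y ⊕ z))                ∎)
  where open ≡-Reasoning
        d = suc N

⊕-identityʳ : (x : Fin (suc N)) → x ⊕ zero ≡ x
⊕-identityʳ x = toℕ-injective (begin
  toℕ (x ⊕ zero)  ≡⟨ toℕ-⊕ x zero ⟩
  (toℕ x + 0) % _ ≡⟨ cong (_% _) (ℕ.+-identityʳ (toℕ x)) ⟩
  toℕ x % _       ≡⟨ m<n⇒m%n≡m (toℕ<n x) ⟩
  toℕ x           ∎)
  where open ≡-Reasoning

⊕-identityˡ : (x : Fin (suc N)) → zero ⊕ x ≡ x
⊕-identityˡ x = trans (⊕-comm zero x) (⊕-identityʳ x)

-_ : Fin (suc N) → Fin (suc N)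
-_ {N} x = (suc N ∸ toℕ x) mod suc N

⊕-inverseʳ : (x : Fin (suc N)) → x ⊕ (- x) ≡ zero
⊕-inverseʳ {N} x = toℕ-injective (begin
  toℕ (x ⊕ (- x))                       ≡⟨ toℕ-⊕ x (- x) ⟩
  (toℕ x + toℕ (- x)) % d               ≡⟨ cong (λ t → (toℕ x + t) % d) (toℕ-mod (d ∸ toℕ x)) ⟩
  (toℕ x + (d ∸ toℕ x) % d) % d         ≡⟨ [m+n%d]%d≡[m+n]%d (toℕ x) (d ∸ toℕ x) d ⟩
  (toℕ x + (d ∸ toℕ x)) % d             ≡⟨ cong (_% d) (ℕ.m+[n∸m]≡n (ℕ.<⇒≤ (toℕ<n x))) ⟩
  d % d                                 ≡⟨ n%n≡0 d ⟩
  0                                     ∎)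
  where open ≡-Reasoning
        d = suc N

⊕-cancelʳ : (g x y : Fin (suc N)) → x ⊕ g ≡ y ⊕ g → x ≡ y
⊕-cancelʳ g x y eq = begin
  x                ≡⟨ ⊕-identityʳ x ⟨
  x ⊕ zero         ≡⟨ cong (x ⊕_) (⊕-inverseʳ g) ⟨
  x ⊕ (g ⊕ (- g))  ≡⟨ ⊕-assoc x g (- g) ⟨
  (x ⊕ g) ⊕ (- g)  ≡⟨ cong (_⊕ (- g)) eq ⟩
  (y ⊕ g) ⊕ (- g)  ≡⟨ ⊕-assoc y g (- g) ⟩
  y ⊕ (g ⊕ (- g))  ≡⟨ cong (y ⊕_) (⊕-inverseʳ g) ⟩
  y ⊕ zero         ≡⟨ ⊕-identityʳ y ⟩
  y                ∎
  where open ≡-Reasoning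

⊕-cancelˡ : (g x y : Fin (suc N)) → g ⊕ x ≡ g ⊕ y → x ≡ y
⊕-cancelˡ g x y eq = ⊕-cancelʳ g x y (trans (⊕-comm x g) (trans eq (⊕-comm g y)))

_⊖_ : Fin (suc N) → Fin (suc N) → Fin (suc N)
x ⊖ y = x ⊕ (- y)

x⊕[y⊖x]≡y : (x y : Fin (suc N)) → x ⊕ (y ⊖ x) ≡ y
x⊕[y⊖x]≡y x y = begin
  x ⊕ (y ⊕ (- x))  ≡⟨ cong (x ⊕_) (⊕-comm y (- x)) ⟩
  x ⊕ ((- x) ⊕ y)  ≡⟨ ⊕-assoc x (- x) y ⟨
  (x ⊕ (- x)) ⊕ y  ≡⟨ cong (_⊕ y) (⊕-inverseʳ x) ⟩
  zero ⊕ y         ≡⟨ ⊕-identityˡ y ⟩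
  y                ∎
  where open ≡-Reasoning

x⊖y≡0⇒x≡y : {x y : Fin (suc N)} → x ⊖ y ≡ zero → x ≡ y
x⊖y≡0⇒x≡y {x = x} {y} eq = begin
  x             ≡⟨ x⊕[y⊖x]≡y y x ⟨
  y ⊕ (x ⊖ y)   ≡⟨ cong (y ⊕_) eq ⟩
  y ⊕ zero      ≡⟨ ⊕-identityʳ y ⟩
  y             ∎
  where open ≡-Reasoning

[x⊕y]⊕z≡[x⊕z]⊕y : (x y z : Fin (suc N)) → (x ⊕ y) ⊕ z ≡ (x ⊕ z) ⊕ y
[x⊕y]⊕z≡[x⊕z]⊕y x y z = begin
  (x ⊕ y) ⊕ z  ≡⟨ ⊕-assoc x y z ⟩
  x ⊕ (y ⊕ z)  ≡⟨ cong (x ⊕_) (⊕-comm y z) ⟩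
  x ⊕ (z ⊕ y)  ≡⟨ ⊕-assoc x z y ⟨
  (x ⊕ z) ⊕ y  ∎
  where open ≡-Reasoning

y⊖x≡y′⊖x′⇒y⊕[x′⊖x]≡y′ : (x y x′ y′ : Fin (suc N)) → y ⊖ x ≡ y′ ⊖ x′ → y ⊕ (x′ ⊖ x) ≡ y′
y⊖x≡y′⊖x′⇒y⊕[x′⊖x]≡y′ x y x′ y′ same-step = begin
  y ⊕ (x′ ⊖ x)              ≡⟨ cong (_⊕ (x′ ⊖ x)) (x⊕[y⊖x]≡y x y) ⟨
  (x ⊕ (y ⊖ x)) ⊕ (x′ ⊖ x)  ≡⟨ [x⊕y]⊕z≡[x⊕z]⊕y x (y ⊖ x) (x′ ⊖ x) ⟩
  (x ⊕ (x′ ⊖ x)) ⊕ (y ⊖ x)  ≡⟨ cong₂ _⊕_ (x⊕[y⊖x]≡y x x′) same-step ⟩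
  x′ ⊕ (y′ ⊖ x′)            ≡⟨ x⊕[y⊖x]≡y x′ y′ ⟩
  y′                        ∎
  where open ≡-Reasoning

x≡-y⇒y⊕x≡0 : (y : Fin (suc N)) {x : Fin (suc N)} → x ≡ - y → y ⊕ x ≡ zero
x≡-y⇒y⊕x≡0 y eq = trans (cong (y ⊕_) eq) (⊕-inverseʳ y)

one : Fin (suc (suc N))
one = suc zero

one⊕one≢zero : one {suc N} ⊕ one ≢ zero
one⊕one≢zero ()

x⊕g≡x⇒g≡0 : (x g : Fin (suc N)) → x ⊕ g ≡ x → g ≡ zero
x⊕g≡x⇒g≡0 x g eq = ⊕-cancelˡ x g zero (trans eq (sym (⊕-identityʳ x)))

[x⊕1]⊕1≢x : (x : Fin (suc (suc (suc N)))) → (x ⊕ one) ⊕ one ≢ x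
[x⊕1]⊕1≢x x eq = one⊕one≢zero (x⊕g≡x⇒g≡0 x (one ⊕ one) (trans (sym (⊕-assoc x one one)) eq))

zero≢-one : zero ≢ - one {N}
zero≢-one eq with trans (sym (⊕-identityʳ one)) (x≡-y⇒y⊕x≡0 one eq)
... | ()

one≢-one : one ≢ - one {suc N}
one≢-one eq = one⊕one≢zero (x≡-y⇒y⊕x≡0 one eq)

suc-mod≡mod⊕one : ∀ t → suc t mod suc (suc N) ≡ (t mod suc (suc N)) ⊕ one
suc-mod≡mod⊕one {N} t = toℕ-injective (begin
  toℕ (suc t mod d)              ≡⟨ toℕ-mod (suc t) ⟩
  suc t % d                      ≡⟨ cong (_% d) (ℕ.+-comm 1 t) ⟩
  (t + 1) % d                    ≡⟨ [m%d+n]%d≡[m+n]%d t 1 d ⟨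
  (t % d + 1) % d                ≡⟨ cong (λ s → (s + 1) % d) (toℕ-mod t) ⟨
  (toℕ (t mod d) + 1) % d        ≡⟨ toℕ-⊕ (t mod d) one ⟨
  toℕ ((t mod d) ⊕ one)          ∎)
  where open ≡-Reasoning
        d = suc (suc N)

mod-toℕ : (x : Fin (suc N)) → toℕ x mod suc N ≡ x
mod-toℕ x = toℕ-injective (trans (toℕ-mod (toℕ x)) (m<n⇒m%n≡m (toℕ<n x)))

⊕one-induction : (P : Fin (suc (suc N)) → Set) → P zero → (∀ x → P x → P (x ⊕ one)) → ∀ x → P x
⊕one-induction {N} P P0 P+1 x = subst P (mod-toℕ x) (P-mod (toℕ x))
  where
  P-mod : ∀ t → P (t mod suc (suc N))
  P-mod zero    = P0
  P-mod (suc t) = subst P (sym (suc-mod≡mod⊕one t)) (P+1 _ (P-mod t))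

next≡⊕one : (i : Fin (suc (suc N))) → next i ≡ i ⊕ one
next≡⊕one i = cong (_mod _) (ℕ.+-comm 1 (toℕ i))

next≢id : (i : Fin (suc (suc N))) → next i ≢ i
next≢id i eq with x⊕g≡x⇒g≡0 i one (trans (sym (next≡⊕one i)) eq)
... | ()

next²≢id : (i : Fin (suc (suc (suc N)))) → next (next i) ≢ i
next²≢id i eq = [x⊕1]⊕1≢x i (begin
  (i ⊕ one) ⊕ one  ≡⟨ next≡⊕one (i ⊕ one) ⟨
  next (i ⊕ one)   ≡⟨ cong next (next≡⊕one i) ⟨
  next (next i)    ≡⟨ eq ⟩
  i                ∎)
  where open ≡-Reasoning

next[i⊖one]≡i : (i : Fin (suc (suc N))) → next (i ⊖ one) ≡ i
next[i⊖one]≡i i = begin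
  next (i ⊖ one)     ≡⟨ next≡⊕one (i ⊖ one) ⟩
  (i ⊖ one) ⊕ one    ≡⟨ ⊕-comm (i ⊖ one) one ⟩
  one ⊕ (i ⊖ one)    ≡⟨ x⊕[y⊖x]≡y one i ⟩
  i                  ∎
  where open ≡-Reasoning

module _ {m n} (f : Fin m → Fin (suc n)) {x : Fin (suc n)} (x∉f : ∀ i → x ≢ f i) where

  punchOutᶠ : Fin m → Fin n
  punchOutᶠ i = punchOut (x∉f i)

  punchOutᶠ-injective : Injective _≡_ _≡_ f → Injective _≡_ _≡_ punchOutᶠ
  punchOutᶠ-injective f-inj eq = f-inj (punchOut-injective (x∉f _) (x∉f _) eq)

  punchOutᶠ-avoids : ∀ {y} (x≢y : x ≢ y) → (∀ i → y ≢ f i) → ∀ i → punchOut x≢y ≢ punchOutᶠ i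
  punchOutᶠ-avoids x≢y y∉f i eq = y∉f i (punchOut-injective x≢y (x∉f i) eq)

injective-avoiding₃⇒≤ : ∀ {m n} (f : Fin m → Fin (suc (suc (suc n)))) {x y z} → Injective _≡_ _≡_ f →
                        x ≢ y → x ≢ z → y ≢ z → (∀ i → x ≢ f i) → (∀ i → y ≢ f i) → (∀ i → z ≢ f i) → m ≤ n
injective-avoiding₃⇒≤ {m} {n} f f-inj x≢y x≢z y≢z x∉f y∉f z∉f = injective⇒≤ (punchOutᶠ-injective f″ z″∉f″ f″-inj)
  where
  f′ : Fin m → Fin (suc (suc n))
  f′ = punchOutᶠ f x∉f
  y′∉f′ : ∀ i → punchOut x≢y ≢ f′ i
  y′∉f′ = punchOutᶠ-avoids f x∉f x≢y y∉f
  y′≢z′ : punchOut x≢y ≢ punchOut x≢z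
  y′≢z′ = y≢z ∘ punchOut-injective x≢y x≢z
  f″ : Fin m → Fin (suc n)
  f″ = punchOutᶠ f′ y′∉f′
  f″-inj : Injective _≡_ _≡_ f″
  f″-inj = punchOutᶠ-injective f′ y′∉f′ (punchOutᶠ-injective f x∉f f-inj)
  z″∉f″ : ∀ i → punchOut y′≢z′ ≢ f″ i
  z″∉f″ = punchOutᶠ-avoids f′ y′∉f′ y′≢z′ (punchOutᶠ-avoids f x∉f x≢z z∉f)

all≡⇒≤1 : ∀ {m} {i : Fin m} → (∀ j → j ≡ i) → m ≤ 1
all≡⇒≤1 all≡i = injective⇒≤ {f = λ _ → zero {0}} λ {j} {j′} _ → trans (all≡i j) (sym (all≡i j′))

EdgeAt : Walk ℓ n → Fin ℓ → Fin n → Fin n → Set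
EdgeAt c i x y = (c i ≡ x × c (next i) ≡ y) ⊎ (c i ≡ y × c (next i) ≡ x)

HasEdge-sym : {c : Walk ℓ n} {x y : Fin n} → HasEdge c x y → HasEdge c y x
HasEdge-sym (i , inj₁ e) = i , inj₂ e
HasEdge-sym (i , inj₂ e) = i , inj₁ e

HasEdge-shift : {c : Walk ℓ n} {x y : Fin n} (g : Fin n) → HasEdge c x y → HasEdge (shiftC g c) (x ⊕ g) (y ⊕ g)
HasEdge-shift g (i , inj₁ (cᵢ≡x , cᵢ₊₁≡y)) = i , inj₁ (cong (_⊕ g) cᵢ≡x , cong (_⊕ g) cᵢ₊₁≡y)
HasEdge-shift g (i , inj₂ (cᵢ≡y , cᵢ₊₁≡x)) = i , inj₂ (cong (_⊕ g) cᵢ≡y , cong (_⊕ g) cᵢ₊₁≡x)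

EdgeAt-unit-unique : {c : Walk ℓ (suc (suc (suc N)))} {i : Fin ℓ} {g h : Fin (suc (suc (suc N)))} →
                     EdgeAt c i g (g ⊕ one) → EdgeAt c i h (h ⊕ one) → g ≡ h
EdgeAt-unit-unique (inj₁ (cᵢ≡g , _)) (inj₁ (cᵢ≡h , _)) = trans (sym cᵢ≡g) cᵢ≡h
EdgeAt-unit-unique (inj₂ (_ , cᵢ₊₁≡g)) (inj₂ (_ , cᵢ₊₁≡h)) = trans (sym cᵢ₊₁≡g) cᵢ₊₁≡h
EdgeAt-unit-unique {h = h} (inj₁ (cᵢ≡g , cᵢ₊₁≡g⊕1)) (inj₂ (cᵢ≡h⊕1 , cᵢ₊₁≡h)) =
  ⊥-elim ([x⊕1]⊕1≢x h (trans (cong (_⊕ one) (trans (sym cᵢ≡h⊕1) cᵢ≡g)) (trans (sym cᵢ₊₁≡g⊕1) cᵢ₊₁≡h)))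
EdgeAt-unit-unique {c = c} e@(inj₂ _) e′@(inj₁ _) = sym (EdgeAt-unit-unique {c = c} e′ e)

all-unit-edges⇒n≤ℓ : (c : Walk ℓ (suc (suc (suc N)))) → (∀ h → HasEdge c h (h ⊕ one)) → suc (suc (suc N)) ≤ ℓ
all-unit-edges⇒n≤ℓ c unit = injective⇒≤ {f = λ h → proj₁ (unit h)} (λ {g} {h} pos-eq →
  EdgeAt-unit-unique {c = c} (proj₂ (unit g)) (subst (λ i → EdgeAt c i h (h ⊕ one)) (sym pos-eq) (proj₂ (unit h))))

other-neighbour : {c : Walk (suc (suc (suc ℓ))) n} {x y : Fin n} → IsCycle c → HasEdge c x y →
                  ∃ λ w → w ≢ x × w ≢ y × HasEdge c x w
other-neighbour {c = c} injective (p , inj₁ (cₚ≡x , cₚ₊₁≡y)) =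
  c q , (λ e → next≢id q (trans nq (sym (injective q p (trans e (sym cₚ≡x))))))
      , (λ e → next²≢id q (trans (cong next nq) (sym (injective q (next p) (trans e (sym cₚ₊₁≡y))))))
      , (q , inj₂ (refl , trans (cong c nq) cₚ≡x))
  where
  q : Fin _
  q = p ⊖ one
  nq : next q ≡ p
  nq = next[i⊖one]≡i p
other-neighbour {c = c} injective (p , inj₂ (cₚ≡y , cₚ₊₁≡x)) =
  c (next (next p)) , (λ e → next≢id (next p) (injective _ _ (trans e (sym cₚ₊₁≡x))))
                    , (λ e → next²≢id p (injective _ _ (trans e (sym cₚ≡y))))
                    , (next p , inj₁ (cₚ₊₁≡x , refl))

cycle : (F : CycleSystem ℓ n) → Fin (length (cycles F)) → Walk ℓ n
cycle F = lookup (cycles F)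

cycle-unique : (F : CycleSystem ℓ n) {x y : Fin n} → x ≢ y → ∀ {k k′} →
               HasEdge (cycle F k) x y → HasEdge (cycle F k′) x y → k ≡ k′
cycle-unique F x≢y hₖ hₖ′ with partition F _ _ x≢y
... | _ , _ , only = trans (only _ hₖ) (sym (only _ hₖ′))

Period : Fin n → Walk ℓ n → Set
Period g c = ∀ {u v} → HasEdge c u v → HasEdge c (u ⊕ g) (v ⊕ g)

-- C + g is a cycle of F sharing the edge {x + g, y + g} with C, hence C + g = C.
period-from-edge : (F : CycleSystem ℓ (suc N)) → Cyclic F → ∀ {k x y g} → x ≢ y →
                   HasEdge (cycle F k) x y → HasEdge (cycle F k) (x ⊕ g) (y ⊕ g) → Period g (cycle F k)
period-from-edge F cyclic {k} {x} {y} {g} x≢y hxy hxy+g huv =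
  subst (λ k″ → HasEdge (cycle F k″) _ _) k′≡k (proj₂ (same _ _) (HasEdge-shift g huv))
  where
  k′ : Fin (length (cycles F))
  k′ = proj₁ (cyclic k g)
  same : SameCycle (cycle F k′) (shiftC g (cycle F k))
  same = proj₂ (cyclic k g)
  k′≡k : k′ ≡ k
  k′≡k = cycle-unique F (λ e → x≢y (⊕-cancelʳ g x y e)) (proj₂ (same _ _) (HasEdge-shift g hxy)) hxy+g

repeated-step : (c : Walk ℓ (suc N)) → (∀ p → c (next p) ≢ c p) → suc N ≤ ℓ →
                ∃ λ p → ∃ λ q → p < q × c (next p) ⊖ c p ≡ c (next q) ⊖ c q
repeated-step c moves n≤ℓ =
  let p , q , p<q , eq = pigeonhole n≤ℓ (λ p → punchOut (step≢0 p))
  in  p , q , p<q , punchOut-injective (step≢0 p) (step≢0 q) eq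
  where
  step≢0 : ∀ p → zero ≢ c (next p) ⊖ c p
  step≢0 p eq = moves p (x⊖y≡0⇒x≡y (sym eq))

long-cycle-has-period : (F : CycleSystem (suc (suc ℓ)) (suc N)) → Cyclic F → ∀ k → suc N ≤ suc (suc ℓ) →
                        ∃ λ g → g ≢ zero × Period g (cycle F k)
long-cycle-has-period F cyclic k n≤ℓ = from-repeated-step (repeated-step c (λ p → next≢id p ∘ injective _ _) n≤ℓ)
  where
  c : Walk _ _
  c = cycle F k
  injective : IsCycle c
  injective = isCycle F k
  from-repeated-step : (∃ λ p → ∃ λ q → p < q × c (next p) ⊖ c p ≡ c (next q) ⊖ c q) → ∃ λ g → g ≢ zero × Period g c
  from-repeated-step (p , q , p<q , same-step) =
    c q ⊖ c p
    , (λ g≡0 → <⇒≢ p<q (sym (injective q p (x⊖y≡0⇒x≡y g≡0))))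
    , period-from-edge F cyclic (λ e → next≢id p (sym (injective p (next p) e)))
        (p , inj₁ (refl , refl))
        (q , inj₁ (sym (x⊕[y⊖x]≡y (c p) (c q))
                 , sym (y⊖x≡y′⊖x′⇒y⊕[x′⊖x]≡y′ (c p) (c (next p)) (c q) (c (next q)) same-step)))

module OrthogonalCyclicSystems
  {ℓ N m : ℕ} (F : Fin m → CycleSystem (suc (suc (suc ℓ))) (suc (suc (suc (suc N)))))
  (cyclic : ∀ i → Cyclic (F i)) (orthogonal : ∀ i i′ → i ≢ i′ → Orthogonal (F i) (F i′)) where

  κ : (i : Fin m) → Fin (length (cycles (F i)))
  κ i = proj₁ (partition (F i) zero one (λ ()))

  C : Fin m → Walk (suc (suc (suc ℓ))) (suc (suc (suc (suc N))))
  C i = cycle (F i) (κ i)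

  C∋01 : ∀ i → HasEdge (C i) zero one
  C∋01 i = proj₁ (proj₂ (partition (F i) zero one (λ ())))

  neighbour : ∀ i → ∃ λ w → w ≢ zero × w ≢ one × HasEdge (C i) zero w
  neighbour i = other-neighbour (isCycle (F i) (κ i)) (C∋01 i)

  w : Fin m → Fin (suc (suc (suc (suc N))))
  w i = proj₁ (neighbour i)

  w≢0 : ∀ i → w i ≢ zero
  w≢0 i = proj₁ (proj₂ (neighbour i))

  w≢1 : ∀ i → w i ≢ one
  w≢1 i = proj₁ (proj₂ (proj₂ (neighbour i)))

  C∋0w : ∀ i → HasEdge (C i) zero (w i)
  C∋0w i = proj₂ (proj₂ (proj₂ (neighbour i)))

  only-common-edge : ∀ {i i′} → i ≢ i′ → ∀ {u v} → HasEdge (C i) u v → HasEdge (C i′) u v →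
                     (zero ≡ u × one ≡ v) ⊎ (zero ≡ v × one ≡ u)
  only-common-edge i≢i′ hᵢ hᵢ′ = orthogonal _ _ i≢i′ _ _ zero one _ _ (C∋01 _ , C∋01 _) (hᵢ , hᵢ′)

  w-injective : Injective _≡_ _≡_ w
  w-injective {i} {i′} wᵢ≡wᵢ′ = decidable-stable (i ≟ i′) λ i≢i′ →
    [ (λ (_ , 1≡w) → w≢1 i (sym 1≡w)) , (λ (0≡w , _) → w≢0 i (sym 0≡w)) ]′
      (only-common-edge i≢i′ (C∋0w i) (subst (HasEdge (C i′) zero) (sym wᵢ≡wᵢ′) (C∋0w i′)))

  w≡-one⇒unique : ∀ {i} → w i ≡ - one → ∀ i′ → i′ ≡ i
  w≡-one⇒unique {i} w≡-1 i′ = decidable-stable (i′ ≟ i) λ i′≢i →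
    let g , g≢0 , period = long-cycle-has-period (F i′) (cyclic i′) (κ i′)
                                                 (all-unit-edges⇒n≤ℓ (C i) hamiltonian)
        C′∋g,g+1 = subst₂ (HasEdge (C i′)) (⊕-identityˡ g) (⊕-comm one g) (period (C∋01 i′))
    in  [ (λ (0≡g , _) → g≢0 (sym 0≡g))
        , (λ (0≡g+1 , 1≡g) → one⊕one≢zero (trans (cong (_⊕ one) 1≡g) (sym 0≡g+1))) ]′
          (only-common-edge i′≢i C′∋g,g+1 (hamiltonian g))
    where
    w⊕1≡0 : w i ⊕ one ≡ zero
    w⊕1≡0 = trans (⊕-comm (w i) one) (x≡-y⇒y⊕x≡0 one w≡-1)
    period-one : Period one (C i)
    period-one = period-from-edge (F i) (cyclic i) (w≢0 i ∘ sym) (C∋0w i)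
                   (subst₂ (HasEdge (C i)) (sym (⊕-identityˡ one)) (sym w⊕1≡0) (HasEdge-sym (C∋01 i)))
    hamiltonian : ∀ h → HasEdge (C i) h (h ⊕ one)
    hamiltonian = ⊕one-induction _ (C∋01 i) (λ _ → period-one)

  m≤1+N : m ≤ suc N
  m≤1+N with any? (λ i → w i ≟ - one)
  ... | yes (_ , w≡-1) = ℕ.≤-trans (all≡⇒≤1 (w≡-one⇒unique w≡-1)) (s≤s z≤n)
  ... | no no-w≡-1 = injective-avoiding₃⇒≤ w w-injective (λ ()) zero≢-one one≢-one
                       (λ i → w≢0 i ∘ sym) (λ i → w≢1 i ∘ sym) (λ i -1≡w → no-w≡-1 (i , sym -1≡w))

lemma22 : (ℓ n m : ℕ) → 3 ≤ ℓ → 4 ≤ n →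
          (F : Fin m → CycleSystem ℓ n) →
          (∀ i → Cyclic (F i)) →
          (∀ i j → i ≢ j → Orthogonal (F i) (F j)) →
          m ≤ n ∸ 3
lemma22 _ _ _ (s≤s (s≤s (s≤s z≤n))) (s≤s (s≤s (s≤s (s≤s z≤n)))) F cyclic orthogonal =
  OrthogonalCyclicSystems.m≤1+N F cyclic orthogonal
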